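{- For every integer $k\geq 2$, there is a cubic graph $G$ having a proper $5$-edge-coloring $c$ with exactly $k$ abnormal edges, i.e. $|N_G(c)|=k$.
   Context: Graphs are finite, undirected, loopless, and may have parallel edges. A proper $5$-edge-coloring assigns colors from $\{1,\dots,5\}$ to edges so that adjacent edges get different colors. For an edge-coloring $c$, $S_c(v)$ is the set of colors on edges incident to $v$. An edge $uv$ of a cubic graph is poor if $|S_c(u)\cup S_c(v)|=3$, rich if $|S_c(u)\cup S_c(v)|=5$, and abnormal otherwise. $N_G(c)$ is the set of abnormal edges of $G$ with respect to $c$. -}

module Defs where

open import Data.Nat using (ℕ)
open import Data.Fin using (Fin; _≟_)
open import Data.Fin.Properties using (any?)
open import Data.Fin.Subset using (Subset; _∪_; ∣_∣)
open import Data.Vec using (tabulate)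
open import Data.List using (List; length; filter)
open import Data.List using () renaming (allFin to allFinL)
open import Data.Product using (_×_; _,_; proj₁; proj₂; ∃)
open import Data.Sum using (_⊎_)
open import Relation.Nullary using (¬_; Dec; does)
open import Relation.Nullary.Decidable using (_⊎-dec_; _×-dec_)
open import Relation.Binary.PropositionalEquality using (_≡_)

record Multigraph : Set where
  field
    n        : ℕ
    m        : ℕ
    ends     : Fin m → Fin n × Fin n
    loopless : ∀ e → ¬ (proj₁ (ends e) ≡ proj₂ (ends e))

module _ (G : Multigraph) where
  open Multigraph G

  Incident : Fin m → Fin n → Set
  Incident e v = (proj₁ (ends e) ≡ v) ⊎ (proj₂ (ends e) ≡ v)

  incident? : ∀ e v → Dec (Incident e v)
  incident? e v = (proj₁ (ends e) ≟ v) ⊎-dec (proj₂ (ends e) ≟ v)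

  -- degree: number of edges incident to v (graph is loopless)
  degree : Fin n → ℕ
  degree v = length (filter (λ e → incident? e v) (allFinL m))

  Cubic : Set
  Cubic = ∀ v → degree v ≡ 3

  Adjacent : Fin m → Fin m → Set
  Adjacent e f = ¬ (e ≡ f) × ∃ λ v → Incident e v × Incident f v

  -- a 5-edge-coloring uses colours Fin 5 (standing for {1,…,5})
  EdgeColoring5 : Set
  EdgeColoring5 = Fin m → Fin 5

  Proper : EdgeColoring5 → Set
  Proper c = ∀ e f → Adjacent e f → ¬ (c e ≡ c f)

  S : EdgeColoring5 → Fin n → Subset 5
  S c v = tabulate λ j → does (any? λ e → incident? e v ×-dec (c e ≟ j))

  spread : EdgeColoring5 → Fin m → ℕ
  spread c e = ∣ S c (proj₁ (ends e)) ∪ S c (proj₂ (ends e)) ∣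

  Poor Rich Abnormal : EdgeColoring5 → Fin m → Set
  Poor c e = spread c e ≡ 3
  Rich c e = spread c e ≡ 5
  Abnormal c e = ¬ Poor c e × ¬ Rich c e

  abnormal? : ∀ c e → Dec (Abnormal c e)
  abnormal? c e = Relation.Nullary.¬? (spread c e Data.Nat.≟ 3)
                  ×-dec Relation.Nullary.¬? (spread c e Data.Nat.≟ 5)

  N : EdgeColoring5 → List (Fin m)
  N c = filter (abnormal? c) (allFinL m)

  numAbnormal : EdgeColoring5 → ℕ
  numAbnormal c = length (N c)

-- A disjoint union of two coloured cubic graphs is a coloured cubic graph in which every edge
-- keeps the colour sets at its ends, so abnormal edges add up. The 4-cycle and the 6-cycle with
-- every other edge doubled have proper 5-edge-colourings with exactly 2 and 3 abnormal edges,
-- and every k ≥ 2 is a sum of 2s and 3s.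
module Submission where

open import Defs
open import Data.Nat using (ℕ; zero; suc; _+_; _≥_; s≤s)
open import Data.Nat.Properties using (+-identityʳ; +-identityˡ)
open import Data.Fin using (Fin; zero; suc; _↑ˡ_; _↑ʳ_; splitAt; #_; _≟_)
open import Data.Fin.Properties
  using (↑ˡ-injective; ↑ʳ-injective; splitAt-↑ˡ; splitAt-↑ʳ; suc-injective; all?; any?)
open import Data.List using (List; []; _∷_; length; filter; map; _++_; tabulate; allFin)
open import Data.List.Properties using (length-++; filter-++; filter-≐; filter-none; map-tabulate)
open import Data.List.Relation.Unary.All.Properties using (tabulate⁺)
open import Data.Vec using (Vec; lookup; []; _∷_)
open import Data.Vec.Properties using (tabulate-cong)
open import Data.Fin.Subset using (_∪_; ∣_∣)
open import Data.Bool using (true; false)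
open import Data.Product as Product using (Σ; _×_; _,_; proj₁; proj₂; ∃-syntax)
open import Data.Sum as Sum using (_⊎_; [_,_]′)
open import Data.Empty using (⊥-elim)
open import Function using (_∘_; id; _⇔_; mk⇔; Equivalence)
open import Relation.Nullary using (¬_; Dec; does)
open import Relation.Nullary.Decidable
  using (True; toWitness; from-yes; map′; does-⇔; ¬?; _→-dec_; _×-dec_)
open import Relation.Unary using (Pred; Decidable)
open import Relation.Binary.PropositionalEquality
  using (_≡_; _≢_; refl; sym; trans; cong; cong₂; subst; module ≡-Reasoning)

open Equivalence using (to; from)

count : ∀ {n p} {P : Pred (Fin n) p} → Decidable P → ℕ
count {n} P? = length (filter P? (allFin n))

length-filter-map : ∀ {a b p} {A : Set a} {B : Set b} {P : Pred B p} (P? : Decidable P)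
                    (f : A → B) (xs : List A) →
                    length (filter P? (map f xs)) ≡ length (filter (P? ∘ f) xs)
length-filter-map P? f [] = refl
length-filter-map P? f (x ∷ xs) with does (P? (f x))
... | true  = cong suc (length-filter-map P? f xs)
... | false = length-filter-map P? f xs

tabulate-+ : ∀ {a} {A : Set a} m {n} (f : Fin (m + n) → A) →
             tabulate f ≡ tabulate (f ∘ (_↑ˡ n)) ++ tabulate (f ∘ (m ↑ʳ_))
tabulate-+ zero    f = refl
tabulate-+ (suc m) f = cong (f zero ∷_) (tabulate-+ m (f ∘ suc))

allFin-+ : ∀ m n → allFin (m + n) ≡ map (_↑ˡ n) (allFin m) ++ map (m ↑ʳ_) (allFin n)
allFin-+ m n = trans (tabulate-+ m id)
  (sym (cong₂ _++_ (map-tabulate id (_↑ˡ n)) (map-tabulate id (m ↑ʳ_))))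

count-+ : ∀ {p} m n {P : Pred (Fin (m + n)) p} (P? : Decidable P) →
          count P? ≡ count (P? ∘ (_↑ˡ n)) + count (P? ∘ (m ↑ʳ_))
count-+ m n P? = begin
  length (filter P? (allFin (m + n)))
    ≡⟨ cong (length ∘ filter P?) (allFin-+ m n) ⟩
  length (filter P? (lefts ++ rights))
    ≡⟨ cong length (filter-++ P? lefts rights) ⟩
  length (filter P? lefts ++ filter P? rights)
    ≡⟨ length-++ (filter P? lefts) ⟩
  length (filter P? lefts) + length (filter P? rights)
    ≡⟨ cong₂ _+_ (length-filter-map P? _ (allFin m)) (length-filter-map P? _ (allFin n)) ⟩
  count (P? ∘ (_↑ˡ n)) + count (P? ∘ (m ↑ʳ_)) ∎
  where
  open ≡-Reasoning
  lefts rights : List (Fin (m + n))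
  lefts = map (_↑ˡ n) (allFin m)
  rights = map (m ↑ʳ_) (allFin n)

count-cong : ∀ {n p q} {P : Pred (Fin n) p} {Q : Pred (Fin n) q}
             (P? : Decidable P) (Q? : Decidable Q) →
             (∀ i → P i ⇔ Q i) → count P? ≡ count Q?
count-cong {n} P? Q? P⇔Q =
  cong length (filter-≐ P? Q? ((λ {i} → to (P⇔Q i)) , (λ {i} → from (P⇔Q i))) (allFin n))

count-∅ : ∀ {n p} {P : Pred (Fin n) p} (P? : Decidable P) → (∀ i → ¬ P i) → count P? ≡ 0
count-∅ P? ¬P = cong length (filter-none P? (tabulate⁺ ¬P))

data Split (m n : ℕ) : Fin (m + n) → Set where
  left  : (i : Fin m) → Split m n (i ↑ˡ n)
  right : (j : Fin n) → Split m n (m ↑ʳ j)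

split : ∀ m n (i : Fin (m + n)) → Split m n i
split zero    n i       = right i
split (suc m) n zero    = left zero
split (suc m) n (suc i) with split m n i
... | left i′  = left (suc i′)
... | right j  = right j

↑ˡ≢↑ʳ : ∀ {m} n (i : Fin m) (j : Fin n) → i ↑ˡ n ≢ m ↑ʳ j
↑ˡ≢↑ʳ n (suc i) j eq = ↑ˡ≢↑ʳ n i j (suc-injective eq)

endpoint-injective : ∀ {a b} {A : Set a} {B : Set b} {f : A → B} →
                     (∀ {x y} → f x ≡ f y → x ≡ y) → ∀ {x y v} →
                     (f x ≡ f v ⊎ f y ≡ f v) ⇔ (x ≡ v ⊎ y ≡ v)
endpoint-injective f-inj = mk⇔ (Sum.map f-inj f-inj) (Sum.map (cong _) (cong _))

spread≡⇒abnormal⇔ : ∀ {G H c d e f} → spread G c e ≡ spread H d f → Abnormal G c e ⇔ Abnormal H d f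
spread≡⇒abnormal⇔ eq = mk⇔ (subst AbnormalSpread eq) (subst AbnormalSpread (sym eq))
  where
  AbnormalSpread : ℕ → Set
  AbnormalSpread s = ¬ s ≡ 3 × ¬ s ≡ 5

ColourAt : (G : Multigraph) → EdgeColoring5 G → Fin (Multigraph.n G) → Fin 5 → Set
ColourAt G c v j = ∃[ e ] Incident G e v × c e ≡ j

S-ext : ∀ {G H c d v w} → (∀ j → ColourAt G c v j ⇔ ColourAt H d w j) → S G c v ≡ S H d w
S-ext {G} {H} {c} {d} {v} {w} same = tabulate-cong λ j → does-⇔ (same j)
  (any? λ e → incident? G e v ×-dec (c e ≟ j)) (any? λ e → incident? H e w ×-dec (d e ≟ j))

module DisjointUnion (G H : Multigraph) where
  open Multigraph G using () renaming (n to n₁; m to m₁; ends to ends₁; loopless to loopless₁)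
  open Multigraph H using () renaming (n to n₂; m to m₂; ends to ends₂; loopless to loopless₂)

  ends : Fin (m₁ + m₂) → Fin (n₁ + n₂) × Fin (n₁ + n₂)
  ends = [ Product.map (_↑ˡ n₂) (_↑ˡ n₂) ∘ ends₁ , Product.map (n₁ ↑ʳ_) (n₁ ↑ʳ_) ∘ ends₂ ]′
       ∘ splitAt m₁

  ends-↑ˡ : ∀ i → ends (i ↑ˡ m₂) ≡ Product.map (_↑ˡ n₂) (_↑ˡ n₂) (ends₁ i)
  ends-↑ˡ i rewrite splitAt-↑ˡ m₁ i m₂ = refl

  ends-↑ʳ : ∀ i → ends (m₁ ↑ʳ i) ≡ Product.map (n₁ ↑ʳ_) (n₁ ↑ʳ_) (ends₂ i)
  ends-↑ʳ i rewrite splitAt-↑ʳ m₁ m₂ i = refl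

  loopless : ∀ e → ¬ proj₁ (ends e) ≡ proj₂ (ends e)
  loopless e with split m₁ m₂ e
  ... | left i  rewrite ends-↑ˡ i = loopless₁ i ∘ ↑ˡ-injective n₂ _ _
  ... | right i rewrite ends-↑ʳ i = loopless₂ i ∘ ↑ʳ-injective n₁ _ _

  graph : Multigraph
  graph = record { n = n₁ + n₂ ; m = m₁ + m₂ ; ends = ends ; loopless = loopless }

  incident-↑ˡ : ∀ i v → Incident graph (i ↑ˡ m₂) (v ↑ˡ n₂) ⇔ Incident G i v
  incident-↑ˡ i v rewrite ends-↑ˡ i = endpoint-injective (↑ˡ-injective n₂ _ _)

  incident-↑ʳ : ∀ i v → Incident graph (m₁ ↑ʳ i) (n₁ ↑ʳ v) ⇔ Incident H i v
  incident-↑ʳ i v rewrite ends-↑ʳ i = endpoint-injective (↑ʳ-injective n₁ _ _)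

  ¬incident-↑ʳ-↑ˡ : ∀ i v → ¬ Incident graph (m₁ ↑ʳ i) (v ↑ˡ n₂)
  ¬incident-↑ʳ-↑ˡ i v rewrite ends-↑ʳ i = [ ↑ˡ≢↑ʳ n₂ v _ ∘ sym , ↑ˡ≢↑ʳ n₂ v _ ∘ sym ]′

  ¬incident-↑ˡ-↑ʳ : ∀ i v → ¬ Incident graph (i ↑ˡ m₂) (n₁ ↑ʳ v)
  ¬incident-↑ˡ-↑ʳ i v rewrite ends-↑ˡ i = [ ↑ˡ≢↑ʳ n₂ _ v , ↑ˡ≢↑ʳ n₂ _ v ]′

  incident-at-↑ˡ : ∀ e v → Incident graph e (v ↑ˡ n₂) → ∃[ i ] e ≡ i ↑ˡ m₂ × Incident G i v
  incident-at-↑ˡ e v e∋v with split m₁ m₂ e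
  ... | left i  = i , refl , to (incident-↑ˡ i v) e∋v
  ... | right i = ⊥-elim (¬incident-↑ʳ-↑ˡ i v e∋v)

  incident-at-↑ʳ : ∀ e v → Incident graph e (n₁ ↑ʳ v) → ∃[ i ] e ≡ m₁ ↑ʳ i × Incident H i v
  incident-at-↑ʳ e v e∋v with split m₁ m₂ e
  ... | left i  = ⊥-elim (¬incident-↑ˡ-↑ʳ i v e∋v)
  ... | right i = i , refl , to (incident-↑ʳ i v) e∋v

  degree-↑ˡ : ∀ v → degree graph (v ↑ˡ n₂) ≡ degree G v
  degree-↑ˡ v = begin
    degree graph (v ↑ˡ n₂)
      ≡⟨ count-+ m₁ m₂ (λ e → incident? graph e (v ↑ˡ n₂)) ⟩
    count (λ i → incident? graph (i ↑ˡ m₂) (v ↑ˡ n₂)) + count (λ i → incident? graph (m₁ ↑ʳ i) (v ↑ˡ n₂))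
      ≡⟨ cong₂ _+_ (count-cong _ _ (λ i → incident-↑ˡ i v)) (count-∅ _ (λ i → ¬incident-↑ʳ-↑ˡ i v)) ⟩
    degree G v + 0
      ≡⟨ +-identityʳ _ ⟩
    degree G v ∎
    where open ≡-Reasoning

  degree-↑ʳ : ∀ v → degree graph (n₁ ↑ʳ v) ≡ degree H v
  degree-↑ʳ v = begin
    degree graph (n₁ ↑ʳ v)
      ≡⟨ count-+ m₁ m₂ (λ e → incident? graph e (n₁ ↑ʳ v)) ⟩
    count (λ i → incident? graph (i ↑ˡ m₂) (n₁ ↑ʳ v)) + count (λ i → incident? graph (m₁ ↑ʳ i) (n₁ ↑ʳ v))
      ≡⟨ cong₂ _+_ (count-∅ _ (λ i → ¬incident-↑ˡ-↑ʳ i v)) (count-cong _ _ (λ i → incident-↑ʳ i v)) ⟩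
    0 + degree H v
      ≡⟨ +-identityˡ _ ⟩
    degree H v ∎
    where open ≡-Reasoning

  cubic : Cubic G → Cubic H → Cubic graph
  cubic G-cubic H-cubic x with split n₁ n₂ x
  ... | left v  = trans (degree-↑ˡ v) (G-cubic v)
  ... | right v = trans (degree-↑ʳ v) (H-cubic v)

  module _ (c₁ : EdgeColoring5 G) (c₂ : EdgeColoring5 H) where

    colouring : EdgeColoring5 graph
    colouring = [ c₁ , c₂ ]′ ∘ splitAt m₁

    colouring-↑ˡ : ∀ i → colouring (i ↑ˡ m₂) ≡ c₁ i
    colouring-↑ˡ i rewrite splitAt-↑ˡ m₁ i m₂ = refl

    colouring-↑ʳ : ∀ i → colouring (m₁ ↑ʳ i) ≡ c₂ i
    colouring-↑ʳ i rewrite splitAt-↑ʳ m₁ m₂ i = refl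

    S-↑ˡ : ∀ v → S graph colouring (v ↑ˡ n₂) ≡ S G c₁ v
    S-↑ˡ v = S-ext {graph} {G} {colouring} {c₁} λ j → mk⇔ (to′ j) (from′ j)
      where
      to′ : ∀ j → ColourAt graph colouring (v ↑ˡ n₂) j → ColourAt G c₁ v j
      to′ j (e , e∋v , ce≡j) with incident-at-↑ˡ e v e∋v
      ... | i , refl , i∋v = i , i∋v , trans (sym (colouring-↑ˡ i)) ce≡j
      from′ : ∀ j → ColourAt G c₁ v j → ColourAt graph colouring (v ↑ˡ n₂) j
      from′ j (i , i∋v , ci≡j) = i ↑ˡ m₂ , from (incident-↑ˡ i v) i∋v , trans (colouring-↑ˡ i) ci≡j

    S-↑ʳ : ∀ v → S graph colouring (n₁ ↑ʳ v) ≡ S H c₂ v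
    S-↑ʳ v = S-ext {graph} {H} {colouring} {c₂} λ j → mk⇔ (to′ j) (from′ j)
      where
      to′ : ∀ j → ColourAt graph colouring (n₁ ↑ʳ v) j → ColourAt H c₂ v j
      to′ j (e , e∋v , ce≡j) with incident-at-↑ʳ e v e∋v
      ... | i , refl , i∋v = i , i∋v , trans (sym (colouring-↑ʳ i)) ce≡j
      from′ : ∀ j → ColourAt H c₂ v j → ColourAt graph colouring (n₁ ↑ʳ v) j
      from′ j (i , i∋v , ci≡j) = m₁ ↑ʳ i , from (incident-↑ʳ i v) i∋v , trans (colouring-↑ʳ i) ci≡j

    spread-↑ˡ : ∀ i → spread graph colouring (i ↑ˡ m₂) ≡ spread G c₁ i
    spread-↑ˡ i =
      trans (cong (λ (u , w) → ∣ S graph colouring u ∪ S graph colouring w ∣) (ends-↑ˡ i))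
            (cong₂ (λ X Y → ∣ X ∪ Y ∣) (S-↑ˡ (proj₁ (ends₁ i))) (S-↑ˡ (proj₂ (ends₁ i))))

    spread-↑ʳ : ∀ i → spread graph colouring (m₁ ↑ʳ i) ≡ spread H c₂ i
    spread-↑ʳ i =
      trans (cong (λ (u , w) → ∣ S graph colouring u ∪ S graph colouring w ∣) (ends-↑ʳ i))
            (cong₂ (λ X Y → ∣ X ∪ Y ∣) (S-↑ʳ (proj₁ (ends₂ i))) (S-↑ʳ (proj₂ (ends₂ i))))

    numAbnormal-colouring : numAbnormal graph colouring ≡ numAbnormal G c₁ + numAbnormal H c₂
    numAbnormal-colouring = trans (count-+ m₁ m₂ (abnormal? graph colouring))
      (cong₂ _+_ (count-cong _ (abnormal? G c₁) left-abnormal⇔)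
                 (count-cong _ (abnormal? H c₂) right-abnormal⇔))
      where
      left-abnormal⇔ : ∀ i → Abnormal graph colouring (i ↑ˡ m₂) ⇔ Abnormal G c₁ i
      left-abnormal⇔ i = spread≡⇒abnormal⇔ {graph} {G} {colouring} {c₁} (spread-↑ˡ i)
      right-abnormal⇔ : ∀ i → Abnormal graph colouring (m₁ ↑ʳ i) ⇔ Abnormal H c₂ i
      right-abnormal⇔ i = spread≡⇒abnormal⇔ {graph} {H} {colouring} {c₂} (spread-↑ʳ i)

    proper : Proper G c₁ → Proper H c₂ → Proper graph colouring
    proper c₁-proper c₂-proper e f (e≢f , x , e∋x , f∋x) with split n₁ n₂ x
    ... | left v with incident-at-↑ˡ e v e∋x | incident-at-↑ˡ f v f∋x
    ...   | i , refl , i∋v | j , refl , j∋v = λ ce≡cf →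
      c₁-proper i j (e≢f ∘ cong (_↑ˡ m₂) , v , i∋v , j∋v)
        (trans (sym (colouring-↑ˡ i)) (trans ce≡cf (colouring-↑ˡ j)))
    proper c₁-proper c₂-proper e f (e≢f , x , e∋x , f∋x) | right v
      with incident-at-↑ʳ e v e∋x | incident-at-↑ʳ f v f∋x
    ...   | i , refl , i∋v | j , refl , j∋v = λ ce≡cf →
      c₂-proper i j (e≢f ∘ cong (m₁ ↑ʳ_) , v , i∋v , j∋v)
        (trans (sym (colouring-↑ʳ i)) (trans ce≡cf (colouring-↑ʳ j)))

loopless? : ∀ {n m} (ends : Fin m → Fin n × Fin n) →
            Dec (∀ e → ¬ proj₁ (ends e) ≡ proj₂ (ends e))
loopless? ends = all? λ e → ¬? (proj₁ (ends e) ≟ proj₂ (ends e))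

fromEdges : ∀ {n m} (es : Vec (Fin n × Fin n) m) → {True (loopless? (lookup es))} → Multigraph
fromEdges {n} {m} es {es-loopless} =
  record { n = n ; m = m ; ends = lookup es ; loopless = toWitness es-loopless }

cubic? : ∀ G → Dec (Cubic G)
cubic? G = all? λ v → degree G v Data.Nat.≟ 3

proper? : ∀ G c → Dec (Proper G c)
proper? G c = map′
  (λ ok e f (e≢f , v , e∋v , f∋v) → ok e f v e≢f e∋v f∋v)
  (λ ok e f v e≢f e∋v f∋v → ok e f (e≢f , v , e∋v , f∋v))
  (all? λ e → all? λ f → all? λ v →
    ¬? (e ≟ f) →-dec incident? G e v →-dec incident? G f v →-dec ¬? (c e ≟ c f))

Realizable : ℕ → Set
Realizable k = Σ Multigraph λ G → Cubic G × Σ (EdgeColoring5 G) λ c → Proper G c × numAbnormal G c ≡ k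

realizable-+ : ∀ {k l} → Realizable k → Realizable l → Realizable (k + l)
realizable-+ (G , G-cubic , c₁ , c₁-proper , c₁-abnormal)
             (H , H-cubic , c₂ , c₂-proper , c₂-abnormal) =
  graph , cubic G-cubic H-cubic , colouring c₁ c₂ , proper c₁ c₂ c₁-proper c₂-proper ,
  trans (numAbnormal-colouring c₁ c₂) (cong₂ _+_ c₁-abnormal c₂-abnormal)
  where open DisjointUnion G H

-- The cycles 0 1 3 2 and 0 1 5 2 3 4 with every other edge doubled; in both colourings exactly
-- the single edges are abnormal.
doubledSquare : Multigraph
doubledSquare = fromEdges {n = 4}
  ((# 0 , # 1) ∷ (# 0 , # 1) ∷ (# 0 , # 2) ∷ (# 1 , # 3) ∷ (# 2 , # 3) ∷ (# 2 , # 3) ∷ [])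

doubledHexagon : Multigraph
doubledHexagon = fromEdges {n = 6}
  ((# 0 , # 1) ∷ (# 0 , # 4) ∷ (# 0 , # 4) ∷ (# 1 , # 5) ∷ (# 1 , # 5) ∷
   (# 2 , # 3) ∷ (# 2 , # 3) ∷ (# 2 , # 5) ∷ (# 3 , # 4) ∷ [])

realizable-2 : Realizable 2
realizable-2 =
  doubledSquare , from-yes (cubic? doubledSquare) , c , from-yes (proper? doubledSquare c) , refl
  where
  c : EdgeColoring5 doubledSquare
  c = lookup (# 0 ∷ # 1 ∷ # 2 ∷ # 2 ∷ # 0 ∷ # 3 ∷ [])

realizable-3 : Realizable 3
realizable-3 =
  doubledHexagon , from-yes (cubic? doubledHexagon) , c , from-yes (proper? doubledHexagon c) , refl
  where
  c : EdgeColoring5 doubledHexagon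
  c = lookup (# 1 ∷ # 4 ∷ # 2 ∷ # 4 ∷ # 0 ∷ # 0 ∷ # 2 ∷ # 1 ∷ # 1 ∷ [])

realizable-2+ : ∀ k → Realizable (2 + k)
realizable-2+ zero          = realizable-2
realizable-2+ (suc zero)    = realizable-3
realizable-2+ (suc (suc k)) = realizable-+ realizable-2 (realizable-2+ k)

proposition4 : (k : ℕ) → k ≥ 2 →
    Σ Multigraph λ G → Cubic G ×
      Σ (EdgeColoring5 G) λ c → Proper G c × numAbnormal G c ≡ k
proposition4 (suc (suc k)) _ = realizable-2+ k
proposition4 (suc zero) (s≤s ())
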